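{- In the restricted intersection type system defined below: (1) if $\Gamma\vdash_r M[N/x]:\delta\mid\Delta$ and $\Gamma\vdash_r N:\delta'\mid\Delta$, then $\Gamma\vdash_r(\lambda x.M)N:\delta\mid\Delta$; (2) if $\Gamma\vdash_r\mu\alpha.c[\alpha\Leftarrow N]:\delta\mid\Delta$ and $\Gamma\vdash_r N:\delta'\mid\Delta$, then $\Gamma\vdash_r(\mu\alpha.c)N:\delta\mid\Delta$.
   Context: Syntax. $\lambda\mu$-terms are $M::=x\mid\lambda x.M\mid MN\mid\mu\alpha.c$ and commands are $c::=[\alpha]M$. $M[N/x]$ is capture-avoiding substitution. Structural substitution is defined by $([\alpha]M)[\alpha\Leftarrow L]=[\alpha](M[\alpha\Leftarrow L])L$ and homomorphically otherwise (through variables, $\lambda$, application, $\mu\beta$, and $[\beta]$ with $\beta\ne\alpha$). Restricted types. With a single constant $\psi$: $\delta::=\kappa\to\psi\mid\delta\wedge\delta$ and $\kappa::=\omega\mid\delta\times\kappa\mid\kappa\wedge\kappa$. The preorders $\le^r_D,\le^r_C$ are the least preorders such that: - $\wedge$ is a meet in each sort; - $\kappa\le^r_C\omega$; - $(\delta_1\times\kappa_1)\wedge(\delta_2\times\kappa_2)\le^r_C(\delta_1\wedge\delta_2)\times(\kappa_1\wedge\kappa_2)$; - $\times$ is covariant; - $\kappa_2\le^r_C\kappa_1\Rightarrow\kappa_1\to\psi\le^r_D\kappa_2\to\psi$. Restricted system. Restricted bases $\Gamma$ are finite maps from variables to restricted term types; restricted contexts $\Delta$ are finite maps from names to restricted continuation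 types, with $\Delta(\alpha)=\omega$ if absent. Rules: - (Ax) $\Gamma,x{:}\delta\vdash_r x:\delta\mid\Delta$; - ($\lambda$) from $\Gamma,x{:}\delta\vdash_r M:\kappa\to\psi\mid\Delta$ infer $\Gamma\vdash_r\lambda x.M:(\delta\times\kappa)\to\psi\mid\Delta$; - (App) from $M:(\delta\times\kappa)\to\psi$ and $N:\delta$ infer $MN:\kappa\to\psi$; - (cmd) from $\Gamma\vdash_r M:\delta\mid\Delta$ infer $\Gamma\vdash_r[\alpha]M:\delta\times\Delta(\alpha)\mid\Delta$; - ($\mu$) from $\Gamma\vdash_r c:(\kappa'\to\psi)\times\kappa'\mid\Delta$ infer $\Gamma\vdash_r\mu\alpha.c:\Delta(\alpha)\to\psi\mid\Delta\setminus\alpha$; - ($\wedge$) and ($\le$) subsumption along $\le^r$. There is no $\omega$-rule. Variables and names in $\Gamma,\Delta$ are not bound in the subject. -}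

module Defs where

open import Data.Nat using (ℕ; zero; suc; pred; _<ᵇ_; _≡ᵇ_)
open import Data.Bool using (if_then_else_)
open import Data.List using (List; []; _∷_)
open import Data.Maybe using (Maybe; just; nothing)
open import Relation.Binary.PropositionalEquality using (_≡_)

-- λμ-syntax, locally nameless-free de Bruijn presentation.
-- Term variables and names (μ-variables) live in two separate index
-- spaces: λ binds term-variable index 0, μ binds name index 0.

mutual
  data Term : Set where
    var : ℕ → Term
    lam : Term → Term
    app : Term → Term → Term
    mu  : Cmd → Term

  data Cmd : Set where
    cmd : ℕ → Term → Cmd

mutual
  shiftV : ℕ → Term → Term
  shiftV c (var i)   = if i <ᵇ c then var i else var (suc i)
  shiftV c (lam M)   = lam (shiftV (suc c) M)
  shiftV c (app M N) = app (shiftV c M) (shiftV c N)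
  shiftV c (mu k)    = mu (shiftVC c k)

  shiftVC : ℕ → Cmd → Cmd
  shiftVC c (cmd α M) = cmd α (shiftV c M)

mutual
  shiftN : ℕ → Term → Term
  shiftN c (var i)   = var i
  shiftN c (lam M)   = lam (shiftN c M)
  shiftN c (app M N) = app (shiftN c M) (shiftN c N)
  shiftN c (mu k)    = mu (shiftNC (suc c) k)

  shiftNC : ℕ → Cmd → Cmd
  shiftNC c (cmd α M) = cmd (if α <ᵇ c then α else suc α) (shiftN c M)

mutual
  substV : ℕ → Term → Term → Term
  substV j N (var i)   = if i <ᵇ j then var i else (if i ≡ᵇ j then N else var (pred i))
  substV j N (lam M)   = lam (substV (suc j) (shiftV 0 N) M)
  substV j N (app M P) = app (substV j N M) (substV j N P)
  substV j N (mu k)    = mu (substVC j (shiftN 0 N) k)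

  substVC : ℕ → Term → Cmd → Cmd
  substVC j N (cmd α M) = cmd α (substV j N M)

-- M[N/x] where x is the variable bound by the enclosing λ (index 0)
_[_/0] : Term → Term → Term
M [ N /0] = substV 0 N M

-- structural substitution c[α ⇐ L] where α is name index k
mutual
  structV : ℕ → Term → Term → Term
  structV k L (var i)   = var i
  structV k L (lam M)   = lam (structV k (shiftV 0 L) M)
  structV k L (app M P) = app (structV k L M) (structV k L P)
  structV k L (mu c)    = mu (structC (suc k) (shiftN 0 L) c)

  structC : ℕ → Term → Cmd → Cmd
  structC k L (cmd β M) =
    if β ≡ᵇ k then cmd β (app (structV k L M) L) else cmd β (structV k L M)

-- μα.c[α ⇐ N]  for the redex (μα.c)N : α is name 0 of c, N is weakened
-- over the μ-binder.
muStruct : Cmd → Term → Term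
muStruct c N = mu (structC 0 (shiftN 0 N) c)

infixr 7 _×ᶜ_
infixl 6 _∧ᵈ_ _∧ᶜ_

mutual
  data D : Set where
    _⇒ψ  : C → D
    _∧ᵈ_ : D → D → D

  data C : Set where
    ω    : C
    _×ᶜ_ : D → C → C
    _∧ᶜ_ : C → C → C

infix 4 _≤D_ _≤C_

mutual
  data _≤D_ : D → D → Set where
    ≤D-refl  : ∀ {δ} → δ ≤D δ
    ≤D-trans : ∀ {δ₁ δ₂ δ₃} → δ₁ ≤D δ₂ → δ₂ ≤D δ₃ → δ₁ ≤D δ₃
    ∧D-lb₁   : ∀ {δ₁ δ₂} → δ₁ ∧ᵈ δ₂ ≤D δ₁
    ∧D-lb₂   : ∀ {δ₁ δ₂} → δ₁ ∧ᵈ δ₂ ≤D δ₂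
    ∧D-glb   : ∀ {δ δ₁ δ₂} → δ ≤D δ₁ → δ ≤D δ₂ → δ ≤D δ₁ ∧ᵈ δ₂
    ⇒-contra : ∀ {κ₁ κ₂} → κ₂ ≤C κ₁ → κ₁ ⇒ψ ≤D κ₂ ⇒ψ

  data _≤C_ : C → C → Set where
    ≤C-refl  : ∀ {κ} → κ ≤C κ
    ≤C-trans : ∀ {κ₁ κ₂ κ₃} → κ₁ ≤C κ₂ → κ₂ ≤C κ₃ → κ₁ ≤C κ₃
    ∧C-lb₁   : ∀ {κ₁ κ₂} → κ₁ ∧ᶜ κ₂ ≤C κ₁
    ∧C-lb₂   : ∀ {κ₁ κ₂} → κ₁ ∧ᶜ κ₂ ≤C κ₂
    ∧C-glb   : ∀ {κ κ₁ κ₂} → κ ≤C κ₁ → κ ≤C κ₂ → κ ≤C κ₁ ∧ᶜ κ₂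
    ≤ω       : ∀ {κ} → κ ≤C ω
    ×-dist   : ∀ {δ₁ δ₂ κ₁ κ₂} →
               (δ₁ ×ᶜ κ₁) ∧ᶜ (δ₂ ×ᶜ κ₂) ≤C (δ₁ ∧ᵈ δ₂) ×ᶜ (κ₁ ∧ᶜ κ₂)
    ×-mono   : ∀ {δ₁ δ₂ κ₁ κ₂} → δ₁ ≤D δ₂ → κ₁ ≤C κ₂ → δ₁ ×ᶜ κ₁ ≤C δ₂ ×ᶜ κ₂

Base : Set
Base = List (Maybe D)       -- nothing / beyond the end = variable absent

Ctx : Set
Ctx = List C                -- beyond the end = ω

lookupΓ : Base → ℕ → Maybe D
lookupΓ []      _       = nothing
lookupΓ (d ∷ Γ) zero    = d
lookupΓ (d ∷ Γ) (suc i) = lookupΓ Γ i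

lookupΔ : Ctx → ℕ → C
lookupΔ []      _       = ω
lookupΔ (κ ∷ Δ) zero    = κ
lookupΔ (κ ∷ Δ) (suc α) = lookupΔ Δ α

infix 3 _⊢_∶_∣_ _⊢ᶜ_∶_∣_

mutual
  data _⊢_∶_∣_ (Γ : Base) : Term → D → Ctx → Set where
    ax  : ∀ {i δ Δ} → lookupΓ Γ i ≡ just δ → Γ ⊢ var i ∶ δ ∣ Δ
    lam : ∀ {M δ κ Δ} → (just δ ∷ Γ) ⊢ M ∶ κ ⇒ψ ∣ Δ →
          Γ ⊢ lam M ∶ (δ ×ᶜ κ) ⇒ψ ∣ Δ
    app : ∀ {M N δ κ Δ} → Γ ⊢ M ∶ (δ ×ᶜ κ) ⇒ψ ∣ Δ → Γ ⊢ N ∶ δ ∣ Δ →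
          Γ ⊢ app M N ∶ κ ⇒ψ ∣ Δ
    mu  : ∀ {c κ κ' Δ} → Γ ⊢ᶜ c ∶ (κ' ⇒ψ) ×ᶜ κ' ∣ (κ ∷ Δ) →
          Γ ⊢ mu c ∶ κ ⇒ψ ∣ Δ
    ∧I  : ∀ {M δ₁ δ₂ Δ} → Γ ⊢ M ∶ δ₁ ∣ Δ → Γ ⊢ M ∶ δ₂ ∣ Δ → Γ ⊢ M ∶ δ₁ ∧ᵈ δ₂ ∣ Δ
    ≤I  : ∀ {M δ δ' Δ} → Γ ⊢ M ∶ δ ∣ Δ → δ ≤D δ' → Γ ⊢ M ∶ δ' ∣ Δ

  data _⊢ᶜ_∶_∣_ (Γ : Base) : Cmd → C → Ctx → Set where
    cmd : ∀ {α M δ Δ} → Γ ⊢ M ∶ δ ∣ Δ → Γ ⊢ᶜ cmd α M ∶ δ ×ᶜ lookupΔ Δ α ∣ Δ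
    ∧I  : ∀ {c κ₁ κ₂ Δ} → Γ ⊢ᶜ c ∶ κ₁ ∣ Δ → Γ ⊢ᶜ c ∶ κ₂ ∣ Δ → Γ ⊢ᶜ c ∶ κ₁ ∧ᶜ κ₂ ∣ Δ
    ≤I  : ∀ {c κ κ' Δ} → Γ ⊢ᶜ c ∶ κ ∣ Δ → κ ≤C κ' → Γ ⊢ᶜ c ∶ κ' ∣ Δ

-- In a derivation for the contractum, every residual of the argument N is typed
-- separately.  Collecting these types into their intersection a, which N has by (∧),
-- we retype the redex with a as the type of x (resp. with a pushed in front of the
-- continuation of α); since typing is antitone in the assumptions, the separately
-- typed pieces of the contractum recombine under the common assumption a.  Without
-- an ω-rule, a contractum in which N does not occur still needs some type for N:
-- this is what the hypothesis N : δ' provides.  Then λx.M and μα.c receive an arrow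
-- type out of a, and applying them to N restores δ.

module Submission where

open import Defs
open import Data.Bool using (true; false; if_then_else_)
open import Data.List using ([]; _∷_)
open import Data.Maybe using (Maybe; just; nothing)
open import Data.Nat using (ℕ; zero; suc; pred; _<_; _≤_; _<ᵇ_; _≡ᵇ_; z≤n; s≤s)
open import Data.Nat.Properties using (<ᵇ-reflects-<; ≡ᵇ⇒≡; ≡⇒≡ᵇ; ≮⇒≥; ≤∧≢⇒<)
open import Function using (_∘_)
open import Data.Product using (_×_; _,_; ∃-syntax)
open import Level using (0ℓ)
open import Relation.Nullary.Reflects using (Reflects; ofʸ; ofⁿ; fromEquivalence)
open import Relation.Unary using (Pred; _⊆_; _∩_; Satisfiable)
open import Relation.Binary.PropositionalEquality using (_≡_; _≢_; refl; sym; trans; cong; ≢-sym)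

≡ᵇ-reflects-≡ : ∀ m n → Reflects (m ≡ n) (m ≡ᵇ n)
≡ᵇ-reflects-≡ m n = fromEquivalence (≡ᵇ⇒≡ m n) (≡⇒≡ᵇ m n)

insertΓ : ℕ → Maybe D → Base → Base
insertΓ zero    x Γ       = x ∷ Γ
insertΓ (suc j) x []      = nothing ∷ insertΓ j x []
insertΓ (suc j) x (m ∷ Γ) = m ∷ insertΓ j x Γ

lookupΓ-insert-< : ∀ {i j} x Γ → i < j → lookupΓ (insertΓ j x Γ) i ≡ lookupΓ Γ i
lookupΓ-insert-< {zero}  x []      (s≤s z≤n)  = refl
lookupΓ-insert-< {zero}  x (m ∷ Γ) (s≤s z≤n)  = refl
lookupΓ-insert-< {suc i} x []      (s≤s i<j) = lookupΓ-insert-< x [] i<j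
lookupΓ-insert-< {suc i} x (m ∷ Γ) (s≤s i<j) = lookupΓ-insert-< x Γ i<j

lookupΓ-insert-≡ : ∀ j x Γ → lookupΓ (insertΓ j x Γ) j ≡ x
lookupΓ-insert-≡ zero    x Γ       = refl
lookupΓ-insert-≡ (suc j) x []      = lookupΓ-insert-≡ j x []
lookupΓ-insert-≡ (suc j) x (m ∷ Γ) = lookupΓ-insert-≡ j x Γ

lookupΓ-insert-≥ : ∀ {i j} x Γ → j ≤ i → lookupΓ (insertΓ j x Γ) (suc i) ≡ lookupΓ Γ i
lookupΓ-insert-≥ x Γ       z≤n       = refl
lookupΓ-insert-≥ x []      (s≤s j≤i) = lookupΓ-insert-≥ x [] j≤i
lookupΓ-insert-≥ x (m ∷ Γ) (s≤s j≤i) = lookupΓ-insert-≥ x Γ j≤i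

lookupΓ-insert-> : ∀ {i j} x Γ → j < i → lookupΓ (insertΓ j x Γ) i ≡ lookupΓ Γ (pred i)
lookupΓ-insert-> x Γ (s≤s j≤i) = lookupΓ-insert-≥ x Γ j≤i

insertΔ : ℕ → C → Ctx → Ctx
insertΔ zero    κ Δ        = κ ∷ Δ
insertΔ (suc c) κ []       = ω ∷ insertΔ c κ []
insertΔ (suc c) κ (κ' ∷ Δ) = κ' ∷ insertΔ c κ Δ

lookupΔ-insert-< : ∀ {α c} κ Δ → α < c → lookupΔ (insertΔ c κ Δ) α ≡ lookupΔ Δ α
lookupΔ-insert-< {zero}  κ []       (s≤s z≤n)  = refl
lookupΔ-insert-< {zero}  κ (κ' ∷ Δ) (s≤s z≤n)  = refl
lookupΔ-insert-< {suc α} κ []       (s≤s α<c) = lookupΔ-insert-< κ [] α<c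
lookupΔ-insert-< {suc α} κ (κ' ∷ Δ) (s≤s α<c) = lookupΔ-insert-< κ Δ α<c

lookupΔ-insert-≥ : ∀ {α c} κ Δ → c ≤ α → lookupΔ (insertΔ c κ Δ) (suc α) ≡ lookupΔ Δ α
lookupΔ-insert-≥ κ Δ        z≤n       = refl
lookupΔ-insert-≥ κ []       (s≤s c≤α) = lookupΔ-insert-≥ κ [] c≤α
lookupΔ-insert-≥ κ (κ' ∷ Δ) (s≤s c≤α) = lookupΔ-insert-≥ κ Δ c≤α

prependΔ : ℕ → D → Ctx → Ctx
prependΔ zero    a []      = (a ×ᶜ ω) ∷ []
prependΔ zero    a (κ ∷ Δ) = (a ×ᶜ κ) ∷ Δ
prependΔ (suc k) a []      = ω ∷ prependΔ k a []
prependΔ (suc k) a (κ ∷ Δ) = κ ∷ prependΔ k a Δ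

lookupΔ-prepend-≡ : ∀ k a Δ → lookupΔ (prependΔ k a Δ) k ≡ a ×ᶜ lookupΔ Δ k
lookupΔ-prepend-≡ zero    a []      = refl
lookupΔ-prepend-≡ zero    a (κ ∷ Δ) = refl
lookupΔ-prepend-≡ (suc k) a []      = lookupΔ-prepend-≡ k a []
lookupΔ-prepend-≡ (suc k) a (κ ∷ Δ) = lookupΔ-prepend-≡ k a Δ

lookupΔ-prepend-≢ : ∀ {α k} a Δ → α ≢ k → lookupΔ (prependΔ k a Δ) α ≡ lookupΔ Δ α
lookupΔ-prepend-≢ {zero}  {zero}  a Δ       0≢0 with () ← 0≢0 refl
lookupΔ-prepend-≢ {zero}  {suc k} a []      _   = refl
lookupΔ-prepend-≢ {zero}  {suc k} a (κ ∷ Δ) _   = refl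
lookupΔ-prepend-≢ {suc α} {zero}  a []      _   = refl
lookupΔ-prepend-≢ {suc α} {zero}  a (κ ∷ Δ) _   = refl
lookupΔ-prepend-≢ {suc α} {suc k} a []      α≢k = lookupΔ-prepend-≢ a [] (α≢k ∘ cong suc)
lookupΔ-prepend-≢ {suc α} {suc k} a (κ ∷ Δ) α≢k = lookupΔ-prepend-≢ a Δ (α≢k ∘ cong suc)

infix 4 _≤Γ_ _≤Δ_

record _≤Γ_ (Γ' Γ : Base) : Set where
  field lookup-≤ : ∀ {i δ} → lookupΓ Γ i ≡ just δ → ∃[ δ' ] lookupΓ Γ' i ≡ just δ' × δ' ≤D δ

open _≤Γ_

∷-≤Γ : ∀ {Γ' Γ} m → Γ' ≤Γ Γ → m ∷ Γ' ≤Γ m ∷ Γ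
lookup-≤ (∷-≤Γ m Γ'≤Γ) {zero}  m≡δ = _ , m≡δ , ≤D-refl
lookup-≤ (∷-≤Γ m Γ'≤Γ) {suc i} i∈Γ = lookup-≤ Γ'≤Γ i∈Γ

insert-≤Γ : ∀ {a' a} j Γ → a' ≤D a → insertΓ j (just a') Γ ≤Γ insertΓ j (just a) Γ
lookup-≤ (insert-≤Γ zero Γ a'≤a) {zero}  refl = _ , refl , a'≤a
lookup-≤ (insert-≤Γ zero Γ a'≤a) {suc i} i∈Γ  = _ , i∈Γ , ≤D-refl
insert-≤Γ (suc j) []      a'≤a = ∷-≤Γ nothing (insert-≤Γ j [] a'≤a)
insert-≤Γ (suc j) (m ∷ Γ) a'≤a = ∷-≤Γ m (insert-≤Γ j Γ a'≤a)

record _≤Δ_ (Δ' Δ : Ctx) : Set where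
  field lookup-≤ : ∀ α → lookupΔ Δ' α ≤C lookupΔ Δ α

open _≤Δ_

∷-≤Δ : ∀ {Δ' Δ} κ → Δ' ≤Δ Δ → κ ∷ Δ' ≤Δ κ ∷ Δ
lookup-≤ (∷-≤Δ κ Δ'≤Δ) zero    = ≤C-refl
lookup-≤ (∷-≤Δ κ Δ'≤Δ) (suc α) = lookup-≤ Δ'≤Δ α

prepend-≤Δ : ∀ {a' a} k Δ → a' ≤D a → prependΔ k a' Δ ≤Δ prependΔ k a Δ
lookup-≤ (prepend-≤Δ zero []      a'≤a) zero    = ×-mono a'≤a ≤C-refl
lookup-≤ (prepend-≤Δ zero (κ ∷ Δ) a'≤a) zero    = ×-mono a'≤a ≤C-refl
lookup-≤ (prepend-≤Δ zero []      a'≤a) (suc α) = ≤C-refl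
lookup-≤ (prepend-≤Δ zero (κ ∷ Δ) a'≤a) (suc α) = ≤C-refl
prepend-≤Δ (suc k) []      a'≤a = ∷-≤Δ ω (prepend-≤Δ k [] a'≤a)
prepend-≤Δ (suc k) (κ ∷ Δ) a'≤a = ∷-≤Δ κ (prepend-≤Δ k Δ a'≤a)

typesOf : Base → Term → Ctx → Pred D 0ℓ
typesOf Γ M Δ δ = Γ ⊢ M ∶ δ ∣ Δ

var-transport : ∀ {Γ Γ' Δ Δ' i i' δ} →
  Γ ⊢ var i ∶ δ ∣ Δ → lookupΓ Γ i ≡ lookupΓ Γ' i' → Γ' ⊢ var i' ∶ δ ∣ Δ'
var-transport (ax i∶δ)   same = ax (trans (sym same) i∶δ)
var-transport (∧I d₁ d₂) same = ∧I (var-transport d₁ same) (var-transport d₂ same)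
var-transport (≤I d δ≤)  same = ≤I (var-transport d same) δ≤

cmd≤ : ∀ {Γ Δ α M δ κ γ} →
  lookupΔ Δ α ≡ κ → Γ ⊢ M ∶ δ ∣ Δ → δ ×ᶜ κ ≤C γ → Γ ⊢ᶜ cmd α M ∶ γ ∣ Δ
cmd≤ refl d ≤γ = ≤I (cmd d) ≤γ

cmd-inversion : ∀ {Γ Δ α M γ} →
  Γ ⊢ᶜ cmd α M ∶ γ ∣ Δ → ∃[ δ ] Γ ⊢ M ∶ δ ∣ Δ × δ ×ᶜ lookupΔ Δ α ≤C γ
cmd-inversion (cmd d) = _ , d , ≤C-refl
cmd-inversion (∧I d₁ d₂) with cmd-inversion d₁ | cmd-inversion d₂
... | δ₁ , M∶δ₁ , ≤γ₁ | δ₂ , M∶δ₂ , ≤γ₂ =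
  δ₁ ∧ᵈ δ₂ , ∧I M∶δ₁ M∶δ₂ ,
  ∧C-glb (≤C-trans (×-mono ∧D-lb₁ ≤C-refl) ≤γ₁) (≤C-trans (×-mono ∧D-lb₂ ≤C-refl) ≤γ₂)
cmd-inversion (≤I d ≤γ) with cmd-inversion d
... | δ , M∶δ , ≤γ' = δ , M∶δ , ≤C-trans ≤γ' ≤γ

mutual
  narrowΓ : ∀ {Γ' Γ Δ M δ} → Γ' ≤Γ Γ → Γ ⊢ M ∶ δ ∣ Δ → Γ' ⊢ M ∶ δ ∣ Δ
  narrowΓ Γ'≤Γ (ax i∶δ) with lookup-≤ Γ'≤Γ i∶δ
  ... | _ , i∶δ' , δ'≤δ = ≤I (ax i∶δ') δ'≤δ
  narrowΓ Γ'≤Γ (lam d)    = lam (narrowΓ (∷-≤Γ _ Γ'≤Γ) d)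
  narrowΓ Γ'≤Γ (app d e)  = app (narrowΓ Γ'≤Γ d) (narrowΓ Γ'≤Γ e)
  narrowΓ Γ'≤Γ (mu d)     = mu (narrowΓᶜ Γ'≤Γ d)
  narrowΓ Γ'≤Γ (∧I d e)   = ∧I (narrowΓ Γ'≤Γ d) (narrowΓ Γ'≤Γ e)
  narrowΓ Γ'≤Γ (≤I d δ≤)  = ≤I (narrowΓ Γ'≤Γ d) δ≤

  narrowΓᶜ : ∀ {Γ' Γ Δ c γ} → Γ' ≤Γ Γ → Γ ⊢ᶜ c ∶ γ ∣ Δ → Γ' ⊢ᶜ c ∶ γ ∣ Δ
  narrowΓᶜ Γ'≤Γ (cmd d)   = cmd (narrowΓ Γ'≤Γ d)
  narrowΓᶜ Γ'≤Γ (∧I d e)  = ∧I (narrowΓᶜ Γ'≤Γ d) (narrowΓᶜ Γ'≤Γ e)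
  narrowΓᶜ Γ'≤Γ (≤I d γ≤) = ≤I (narrowΓᶜ Γ'≤Γ d) γ≤

mutual
  narrowΔ : ∀ {Γ Δ' Δ M δ} → Δ' ≤Δ Δ → Γ ⊢ M ∶ δ ∣ Δ → Γ ⊢ M ∶ δ ∣ Δ'
  narrowΔ Δ'≤Δ (ax i∶δ)   = ax i∶δ
  narrowΔ Δ'≤Δ (lam d)    = lam (narrowΔ Δ'≤Δ d)
  narrowΔ Δ'≤Δ (app d e)  = app (narrowΔ Δ'≤Δ d) (narrowΔ Δ'≤Δ e)
  narrowΔ Δ'≤Δ (mu d)     = mu (narrowΔᶜ (∷-≤Δ _ Δ'≤Δ) d)
  narrowΔ Δ'≤Δ (∧I d e)   = ∧I (narrowΔ Δ'≤Δ d) (narrowΔ Δ'≤Δ e)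
  narrowΔ Δ'≤Δ (≤I d δ≤)  = ≤I (narrowΔ Δ'≤Δ d) δ≤

  narrowΔᶜ : ∀ {Γ Δ' Δ c γ} → Δ' ≤Δ Δ → Γ ⊢ᶜ c ∶ γ ∣ Δ → Γ ⊢ᶜ c ∶ γ ∣ Δ'
  narrowΔᶜ Δ'≤Δ (cmd {α = α} d) =
    ≤I (cmd (narrowΔ Δ'≤Δ d)) (×-mono ≤D-refl (lookup-≤ Δ'≤Δ α))
  narrowΔᶜ Δ'≤Δ (∧I d e)  = ∧I (narrowΔᶜ Δ'≤Δ d) (narrowΔᶜ Δ'≤Δ e)
  narrowΔᶜ Δ'≤Δ (≤I d γ≤) = ≤I (narrowΔᶜ Δ'≤Δ d) γ≤

mutual
  strengthenΓ : ∀ {Γ Δ δ} L c x → insertΓ c x Γ ⊢ shiftV c L ∶ δ ∣ Δ → Γ ⊢ L ∶ δ ∣ Δ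
  strengthenΓ (var i) c x d with i <ᵇ c | <ᵇ-reflects-< i c
  ... | true  | ofʸ i<c = var-transport d (lookupΓ-insert-< x _ i<c)
  ... | false | ofⁿ i≮c = var-transport d (lookupΓ-insert-≥ x _ (≮⇒≥ i≮c))
  strengthenΓ (lam M)   c x (lam d)    = lam (strengthenΓ M (suc c) x d)
  strengthenΓ (lam M)   c x (∧I d e)   = ∧I (strengthenΓ (lam M) c x d) (strengthenΓ (lam M) c x e)
  strengthenΓ (lam M)   c x (≤I d δ≤)  = ≤I (strengthenΓ (lam M) c x d) δ≤
  strengthenΓ (app M P) c x (app d e)  = app (strengthenΓ M c x d) (strengthenΓ P c x e)
  strengthenΓ (app M P) c x (∧I d e)   = ∧I (strengthenΓ (app M P) c x d) (strengthenΓ (app M P) c x e)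
  strengthenΓ (app M P) c x (≤I d δ≤)  = ≤I (strengthenΓ (app M P) c x d) δ≤
  strengthenΓ (mu k)    c x (mu d)     = mu (strengthenΓᶜ k c x d)
  strengthenΓ (mu k)    c x (∧I d e)   = ∧I (strengthenΓ (mu k) c x d) (strengthenΓ (mu k) c x e)
  strengthenΓ (mu k)    c x (≤I d δ≤)  = ≤I (strengthenΓ (mu k) c x d) δ≤

  strengthenΓᶜ : ∀ {Γ Δ γ} k c x → insertΓ c x Γ ⊢ᶜ shiftVC c k ∶ γ ∣ Δ → Γ ⊢ᶜ k ∶ γ ∣ Δ
  strengthenΓᶜ (cmd α M) c x d =
    let δ , M∶δ , ≤γ = cmd-inversion d in cmd≤ refl (strengthenΓ M c x M∶δ) ≤γ

mutual
  strengthenΔ : ∀ {Γ Δ δ} L c κ → Γ ⊢ shiftN c L ∶ δ ∣ insertΔ c κ Δ → Γ ⊢ L ∶ δ ∣ Δ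
  strengthenΔ (var i)   c κ d          = var-transport d refl
  strengthenΔ (lam M)   c κ (lam d)    = lam (strengthenΔ M c κ d)
  strengthenΔ (lam M)   c κ (∧I d e)   = ∧I (strengthenΔ (lam M) c κ d) (strengthenΔ (lam M) c κ e)
  strengthenΔ (lam M)   c κ (≤I d δ≤)  = ≤I (strengthenΔ (lam M) c κ d) δ≤
  strengthenΔ (app M P) c κ (app d e)  = app (strengthenΔ M c κ d) (strengthenΔ P c κ e)
  strengthenΔ (app M P) c κ (∧I d e)   = ∧I (strengthenΔ (app M P) c κ d) (strengthenΔ (app M P) c κ e)
  strengthenΔ (app M P) c κ (≤I d δ≤)  = ≤I (strengthenΔ (app M P) c κ d) δ≤
  strengthenΔ (mu k)    c κ (mu d)     = mu (strengthenΔᶜ k (suc c) κ d)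
  strengthenΔ (mu k)    c κ (∧I d e)   = ∧I (strengthenΔ (mu k) c κ d) (strengthenΔ (mu k) c κ e)
  strengthenΔ (mu k)    c κ (≤I d δ≤)  = ≤I (strengthenΔ (mu k) c κ d) δ≤

  strengthenΔᶜ : ∀ {Γ Δ γ} k c κ → Γ ⊢ᶜ shiftNC c k ∶ γ ∣ insertΔ c κ Δ → Γ ⊢ᶜ k ∶ γ ∣ Δ
  strengthenΔᶜ (cmd α M) c κ d with α <ᵇ c | <ᵇ-reflects-< α c | cmd-inversion d
  ... | true  | ofʸ α<c | δ , M∶δ , ≤γ =
    cmd≤ (sym (lookupΔ-insert-< κ _ α<c)) (strengthenΔ M c κ M∶δ) ≤γ
  ... | false | ofⁿ α≮c | δ , M∶δ , ≤γ =
    cmd≤ (sym (lookupΔ-insert-≥ κ _ (≮⇒≥ α≮c))) (strengthenΔ M c κ M∶δ) ≤γ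

infixr 8 _⇒ᵈ_ _⇒ᶜ_

-- a ⇒ᵈ δ is the arrow from a to δ, distributed over the intersections in δ; a ⇒ᶜ γ
-- is the type of [α]M once M gets such an arrow type and α's continuation gets a.
_⇒ᵈ_ : D → D → D
a ⇒ᵈ (κ ⇒ψ)     = (a ×ᶜ κ) ⇒ψ
a ⇒ᵈ (δ₁ ∧ᵈ δ₂) = a ⇒ᵈ δ₁ ∧ᵈ a ⇒ᵈ δ₂

_⇒ᶜ_ : D → C → C
a ⇒ᶜ ω          = ω
a ⇒ᶜ (δ ×ᶜ κ)   = a ⇒ᵈ δ ×ᶜ (a ×ᶜ κ)
a ⇒ᶜ (κ₁ ∧ᶜ κ₂) = a ⇒ᶜ κ₁ ∧ᶜ a ⇒ᶜ κ₂

⇒ᵈ-monoʳ-≤ : ∀ {a δ₁ δ₂} → δ₁ ≤D δ₂ → a ⇒ᵈ δ₁ ≤D a ⇒ᵈ δ₂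
⇒ᵈ-monoʳ-≤ ≤D-refl          = ≤D-refl
⇒ᵈ-monoʳ-≤ (≤D-trans p q)   = ≤D-trans (⇒ᵈ-monoʳ-≤ p) (⇒ᵈ-monoʳ-≤ q)
⇒ᵈ-monoʳ-≤ ∧D-lb₁           = ∧D-lb₁
⇒ᵈ-monoʳ-≤ ∧D-lb₂           = ∧D-lb₂
⇒ᵈ-monoʳ-≤ (∧D-glb p q)     = ∧D-glb (⇒ᵈ-monoʳ-≤ p) (⇒ᵈ-monoʳ-≤ q)
⇒ᵈ-monoʳ-≤ (⇒-contra κ₂≤κ₁) = ⇒-contra (×-mono ≤D-refl κ₂≤κ₁)

⇒ᵈ-antimonoˡ-≤ : ∀ {a' a} δ → a' ≤D a → a ⇒ᵈ δ ≤D a' ⇒ᵈ δ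
⇒ᵈ-antimonoˡ-≤ (κ ⇒ψ)     a'≤a = ⇒-contra (×-mono a'≤a ≤C-refl)
⇒ᵈ-antimonoˡ-≤ (δ₁ ∧ᵈ δ₂) a'≤a =
  ∧D-glb (≤D-trans ∧D-lb₁ (⇒ᵈ-antimonoˡ-≤ δ₁ a'≤a)) (≤D-trans ∧D-lb₂ (⇒ᵈ-antimonoˡ-≤ δ₂ a'≤a))

⇒ᶜ-monoʳ-≤ : ∀ {a κ₁ κ₂} → κ₁ ≤C κ₂ → a ⇒ᶜ κ₁ ≤C a ⇒ᶜ κ₂
⇒ᶜ-monoʳ-≤ ≤C-refl        = ≤C-refl
⇒ᶜ-monoʳ-≤ (≤C-trans p q) = ≤C-trans (⇒ᶜ-monoʳ-≤ p) (⇒ᶜ-monoʳ-≤ q)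
⇒ᶜ-monoʳ-≤ ∧C-lb₁         = ∧C-lb₁
⇒ᶜ-monoʳ-≤ ∧C-lb₂         = ∧C-lb₂
⇒ᶜ-monoʳ-≤ (∧C-glb p q)   = ∧C-glb (⇒ᶜ-monoʳ-≤ p) (⇒ᶜ-monoʳ-≤ q)
⇒ᶜ-monoʳ-≤ ≤ω             = ≤ω
⇒ᶜ-monoʳ-≤ ×-dist         = ≤C-trans ×-dist (×-mono ≤D-refl (≤C-trans ×-dist (×-mono ∧D-lb₁ ≤C-refl)))
⇒ᶜ-monoʳ-≤ (×-mono p q)   = ×-mono (⇒ᵈ-monoʳ-≤ p) (×-mono ≤D-refl q)

⊢lam-⇒ᵈ : ∀ {Γ Δ M a} δ → just a ∷ Γ ⊢ M ∶ δ ∣ Δ → Γ ⊢ lam M ∶ a ⇒ᵈ δ ∣ Δ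
⊢lam-⇒ᵈ (κ ⇒ψ)     d = lam d
⊢lam-⇒ᵈ (δ₁ ∧ᵈ δ₂) d = ∧I (⊢lam-⇒ᵈ δ₁ (≤I d ∧D-lb₁)) (⊢lam-⇒ᵈ δ₂ (≤I d ∧D-lb₂))

⊢app-⇒ᵈ : ∀ {Γ Δ M N a} δ → Γ ⊢ M ∶ a ⇒ᵈ δ ∣ Δ → Γ ⊢ N ∶ a ∣ Δ → Γ ⊢ app M N ∶ δ ∣ Δ
⊢app-⇒ᵈ (κ ⇒ψ)     d e = app d e
⊢app-⇒ᵈ (δ₁ ∧ᵈ δ₂) d e = ∧I (⊢app-⇒ᵈ δ₁ (≤I d ∧D-lb₁) e) (⊢app-⇒ᵈ δ₂ (≤I d ∧D-lb₂) e)

⊢mu-⇒ᶜ-if : ∀ {Γ Δ c a κ κ'} b →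
  Γ ⊢ᶜ c ∶ (if b then a ⇒ᶜ (κ' ⇒ψ ×ᶜ κ') else κ' ⇒ψ ×ᶜ κ') ∣ κ ∷ Δ → Γ ⊢ mu c ∶ κ ⇒ψ ∣ Δ
⊢mu-⇒ᶜ-if true  d = mu d
⊢mu-⇒ᶜ-if false d = mu d

Antitone : Pred D 0ℓ → Set
Antitone P = ∀ {a b} → b ≤D a → P a → P b

⇒ᵈ-antitone : ∀ {Γ Δ M δ} → Antitone (λ a → Γ ⊢ M ∶ a ⇒ᵈ δ ∣ Δ)
⇒ᵈ-antitone {δ = δ} b≤a M∶a⇒δ = ≤I M∶a⇒δ (⇒ᵈ-antimonoˡ-≤ δ b≤a)

module _ {Γ₀ Δ₀ N₀ δ₀} (N₀∶δ₀ : Γ₀ ⊢ N₀ ∶ δ₀ ∣ Δ₀) where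

  private
    T : Pred D 0ℓ
    T = typesOf Γ₀ N₀ Δ₀

    map∃ : ∀ {P Q : Pred D 0ℓ} → P ⊆ Q → ∃⟨ T ∩ P ⟩ → ∃⟨ T ∩ Q ⟩
    map∃ f (a , N₀∶a , Pa) = a , N₀∶a , f Pa

    zip∃ : ∀ {P Q R : Pred D 0ℓ} → Antitone P → Antitone Q →
      (∀ {a} → P a → Q a → R a) → ∃⟨ T ∩ P ⟩ → ∃⟨ T ∩ Q ⟩ → ∃⟨ T ∩ R ⟩
    zip∃ P↓ Q↓ f (a , N₀∶a , Pa) (b , N₀∶b , Qb) =
      a ∧ᵈ b , ∧I N₀∶a N₀∶b , f (P↓ ∧D-lb₁ Pa) (Q↓ ∧D-lb₂ Qb)

  ArgTyped : ℕ → Base → Ctx → Term → D → Pred D 0ℓ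
  ArgTyped j Γ Δ M δ a = insertΓ j (just a) Γ ⊢ M ∶ δ ∣ Δ

  ArgTyped-antitone : ∀ {j Γ Δ M δ} → Antitone (ArgTyped j Γ Δ M δ)
  ArgTyped-antitone {j} {Γ} b≤a = narrowΓ (insert-≤Γ j Γ b≤a)

  ∧-ArgTyped : ∀ {j Γ Δ M δ₁ δ₂} → ∃⟨ T ∩ ArgTyped j Γ Δ M δ₁ ⟩ → ∃⟨ T ∩ ArgTyped j Γ Δ M δ₂ ⟩ →
    ∃⟨ T ∩ ArgTyped j Γ Δ M (δ₁ ∧ᵈ δ₂) ⟩
  ∧-ArgTyped = zip∃ ArgTyped-antitone ArgTyped-antitone ∧I

  mutual
    unsubst : ∀ {Γ Δ L δ} j M → typesOf Γ L Δ ⊆ T →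
      Γ ⊢ substV j L M ∶ δ ∣ Δ → ∃⟨ T ∩ ArgTyped j Γ Δ M δ ⟩
    unsubst j (var i) L⊆N₀ d with i <ᵇ j | <ᵇ-reflects-< i j
    ... | true  | ofʸ i<j = δ₀ , N₀∶δ₀ , var-transport d (sym (lookupΓ-insert-< _ _ i<j))
    ... | false | ofⁿ i≮j with i ≡ᵇ j | ≡ᵇ-reflects-≡ i j
    ...   | true  | ofʸ refl = _ , L⊆N₀ d , ax (lookupΓ-insert-≡ j _ _)
    ...   | false | ofⁿ i≢j  =
      δ₀ , N₀∶δ₀ , var-transport d (sym (lookupΓ-insert-> _ _ (≤∧≢⇒< (≮⇒≥ i≮j) (≢-sym i≢j))))
    unsubst j (lam M) L⊆N₀ (lam d) =
      map∃ lam (unsubst (suc j) M (λ e → L⊆N₀ (strengthenΓ _ 0 _ e)) d)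
    unsubst j (lam M) L⊆N₀ (∧I d e) =
      ∧-ArgTyped (unsubst j (lam M) L⊆N₀ d) (unsubst j (lam M) L⊆N₀ e)
    unsubst j (lam M) L⊆N₀ (≤I d δ≤) = map∃ (λ d' → ≤I d' δ≤) (unsubst j (lam M) L⊆N₀ d)
    unsubst j (app M P) L⊆N₀ (app d e) =
      zip∃ ArgTyped-antitone ArgTyped-antitone app (unsubst j M L⊆N₀ d) (unsubst j P L⊆N₀ e)
    unsubst j (app M P) L⊆N₀ (∧I d e) =
      ∧-ArgTyped (unsubst j (app M P) L⊆N₀ d) (unsubst j (app M P) L⊆N₀ e)
    unsubst j (app M P) L⊆N₀ (≤I d δ≤) = map∃ (λ d' → ≤I d' δ≤) (unsubst j (app M P) L⊆N₀ d)
    unsubst j (mu k) L⊆N₀ (mu d) =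
      map∃ mu (unsubstᶜ j k (λ e → L⊆N₀ (strengthenΔ _ 0 _ e)) d)
    unsubst j (mu k) L⊆N₀ (∧I d e) =
      ∧-ArgTyped (unsubst j (mu k) L⊆N₀ d) (unsubst j (mu k) L⊆N₀ e)
    unsubst j (mu k) L⊆N₀ (≤I d δ≤) = map∃ (λ d' → ≤I d' δ≤) (unsubst j (mu k) L⊆N₀ d)

    unsubstᶜ : ∀ {Γ Δ L γ} j k → typesOf Γ L Δ ⊆ T →
      Γ ⊢ᶜ substVC j L k ∶ γ ∣ Δ → ∃⟨ T ∩ (λ a → insertΓ j (just a) Γ ⊢ᶜ k ∶ γ ∣ Δ) ⟩
    unsubstᶜ j (cmd α M) L⊆N₀ d =
      let δ , M∶δ , ≤γ = cmd-inversion d in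
      map∃ (λ M∶δ' → cmd≤ refl M∶δ' ≤γ) (unsubst j M L⊆N₀ M∶δ)

  β-expansion : ∀ {M δ} → Γ₀ ⊢ M [ N₀ /0] ∶ δ ∣ Δ₀ → Γ₀ ⊢ app (lam M) N₀ ∶ δ ∣ Δ₀
  β-expansion {M} {δ} d with unsubst 0 M (λ N₀∶a → N₀∶a) d
  ... | a , N₀∶a , M∶δ = ⊢app-⇒ᵈ δ (⊢lam-⇒ᵈ δ M∶δ) N₀∶a

  Pushed : ℕ → Base → Ctx → Term → D → Pred D 0ℓ
  Pushed k Γ Δ M δ a = Γ ⊢ M ∶ δ ∣ prependΔ k a Δ

  Pushed-antitone : ∀ {k Γ Δ M δ} → Antitone (Pushed k Γ Δ M δ)
  Pushed-antitone {k} {Δ = Δ} b≤a = narrowΔ (prepend-≤Δ k Δ b≤a)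

  PushedArg-antitone : ∀ {k Γ Δ M δ} → Antitone (λ a → Pushed k Γ Δ M (a ⇒ᵈ δ) a)
  PushedArg-antitone b≤a M∶a⇒δ = ⇒ᵈ-antitone b≤a (Pushed-antitone b≤a M∶a⇒δ)

  ∧-Pushed : ∀ {k Γ Δ M δ₁ δ₂} → ∃⟨ T ∩ Pushed k Γ Δ M δ₁ ⟩ → ∃⟨ T ∩ Pushed k Γ Δ M δ₂ ⟩ →
    ∃⟨ T ∩ Pushed k Γ Δ M (δ₁ ∧ᵈ δ₂) ⟩
  ∧-Pushed = zip∃ Pushed-antitone Pushed-antitone ∧I

  mutual
    unstruct : ∀ {Γ Δ L δ} k M → typesOf Γ L Δ ⊆ T →
      Γ ⊢ structV k L M ∶ δ ∣ Δ → ∃⟨ T ∩ Pushed k Γ Δ M δ ⟩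
    unstruct k (var i) L⊆N₀ d = δ₀ , N₀∶δ₀ , var-transport d refl
    unstruct k (lam M) L⊆N₀ (lam d) =
      map∃ lam (unstruct k M (λ e → L⊆N₀ (strengthenΓ _ 0 _ e)) d)
    unstruct k (lam M) L⊆N₀ (∧I d e) =
      ∧-Pushed (unstruct k (lam M) L⊆N₀ d) (unstruct k (lam M) L⊆N₀ e)
    unstruct k (lam M) L⊆N₀ (≤I d δ≤) = map∃ (λ d' → ≤I d' δ≤) (unstruct k (lam M) L⊆N₀ d)
    unstruct k (app M P) L⊆N₀ (app d e) =
      zip∃ Pushed-antitone Pushed-antitone app (unstruct k M L⊆N₀ d) (unstruct k P L⊆N₀ e)
    unstruct k (app M P) L⊆N₀ (∧I d e) =
      ∧-Pushed (unstruct k (app M P) L⊆N₀ d) (unstruct k (app M P) L⊆N₀ e)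
    unstruct k (app M P) L⊆N₀ (≤I d δ≤) = map∃ (λ d' → ≤I d' δ≤) (unstruct k (app M P) L⊆N₀ d)
    unstruct k (mu (cmd β M)) L⊆N₀ (mu d) =
      map∃ (⊢mu-⇒ᶜ-if (β ≡ᵇ suc k))
           (unstructᶜ (suc k) β M (λ e → L⊆N₀ (strengthenΔ _ 0 _ e)) d)
    unstruct k (mu c) L⊆N₀ (∧I d e) =
      ∧-Pushed (unstruct k (mu c) L⊆N₀ d) (unstruct k (mu c) L⊆N₀ e)
    unstruct k (mu c) L⊆N₀ (≤I d δ≤) = map∃ (λ d' → ≤I d' δ≤) (unstruct k (mu c) L⊆N₀ d)

    unstructᶜ : ∀ {Γ Δ L γ} k β M → typesOf Γ L Δ ⊆ T →
      Γ ⊢ᶜ structC k L (cmd β M) ∶ γ ∣ Δ →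
      ∃⟨ T ∩ (λ a → Γ ⊢ᶜ cmd β M ∶ (if β ≡ᵇ k then a ⇒ᶜ γ else γ) ∣ prependΔ k a Δ) ⟩
    unstructᶜ {Δ = Δ} k β M L⊆N₀ d with β ≡ᵇ k | ≡ᵇ-reflects-≡ β k
    ... | true  | ofʸ refl =
      let δ , ML∶δ , ≤γ = cmd-inversion d in
      map∃ (λ {a} M∶a⇒δ → cmd≤ (lookupΔ-prepend-≡ β a Δ) M∶a⇒δ (⇒ᶜ-monoʳ-≤ ≤γ))
           (unstruct-app β M L⊆N₀ ML∶δ)
    ... | false | ofⁿ β≢k =
      let δ , M'∶δ , ≤γ = cmd-inversion d in
      map∃ (λ {a} M∶δ → cmd≤ (lookupΔ-prepend-≢ a Δ β≢k) M∶δ ≤γ) (unstruct k M L⊆N₀ M'∶δ)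

    unstruct-app : ∀ {Γ Δ L δ} k M → typesOf Γ L Δ ⊆ T →
      Γ ⊢ app (structV k L M) L ∶ δ ∣ Δ → ∃⟨ T ∩ (λ a → Pushed k Γ Δ M (a ⇒ᵈ δ) a) ⟩
    unstruct-app {Δ = Δ} k M L⊆N₀ (app {δ = δL} d L∶δL) with unstruct k M L⊆N₀ d
    ... | a , N₀∶a , M∶δL⇒ =
      a ∧ᵈ δL , ∧I N₀∶a (L⊆N₀ L∶δL) ,
      ≤I (narrowΔ (prepend-≤Δ k Δ ∧D-lb₁) M∶δL⇒) (⇒-contra (×-mono ∧D-lb₂ ≤C-refl))
    unstruct-app k M L⊆N₀ (∧I d e) =
      zip∃ PushedArg-antitone PushedArg-antitone ∧I
           (unstruct-app k M L⊆N₀ d) (unstruct-app k M L⊆N₀ e)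
    unstruct-app k M L⊆N₀ (≤I d δ≤) =
      map∃ (λ d' → ≤I d' (⇒ᵈ-monoʳ-≤ δ≤)) (unstruct-app k M L⊆N₀ d)

  unstruct-μ : ∀ {c δ} → Γ₀ ⊢ muStruct c N₀ ∶ δ ∣ Δ₀ → ∃⟨ T ∩ (λ a → Γ₀ ⊢ mu c ∶ a ⇒ᵈ δ ∣ Δ₀) ⟩
  unstruct-μ {cmd β M} (mu d) =
    map∃ (⊢mu-⇒ᶜ-if (β ≡ᵇ 0)) (unstructᶜ 0 β M (λ e → strengthenΔ _ 0 _ e) d)
  unstruct-μ (∧I d e)  = zip∃ ⇒ᵈ-antitone ⇒ᵈ-antitone ∧I (unstruct-μ d) (unstruct-μ e)
  unstruct-μ (≤I d δ≤) = map∃ (λ d' → ≤I d' (⇒ᵈ-monoʳ-≤ δ≤)) (unstruct-μ d)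

  μ-expansion : ∀ {c δ} → Γ₀ ⊢ muStruct c N₀ ∶ δ ∣ Δ₀ → Γ₀ ⊢ app (mu c) N₀ ∶ δ ∣ Δ₀
  μ-expansion {δ = δ} d with unstruct-μ d
  ... | a , N₀∶a , mu-c∶a⇒δ = ⊢app-⇒ᵈ δ mu-c∶a⇒δ N₀∶a

lemma6p18 : ((Γ : Base) (Δ : Ctx) (M N : Term) (δ δ' : D) →
               Γ ⊢ M [ N /0] ∶ δ ∣ Δ → Γ ⊢ N ∶ δ' ∣ Δ →
               Γ ⊢ app (lam M) N ∶ δ ∣ Δ)
            × ((Γ : Base) (Δ : Ctx) (c : Cmd) (N : Term) (δ δ' : D) →
               Γ ⊢ muStruct c N ∶ δ ∣ Δ → Γ ⊢ N ∶ δ' ∣ Δ →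
               Γ ⊢ app (mu c) N ∶ δ ∣ Δ)
lemma6p18 = (λ Γ Δ M N δ δ' d N∶δ' → β-expansion N∶δ' d)
          , (λ Γ Δ c N δ δ' d N∶δ' → μ-expansion N∶δ' d)
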